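{- Let $L_1,L_2,L_3$ be mutually UFS Latin squares on the symbol set $\{1,\ldots,n\}$, and for distinct $i,j\in\{1,2,3\}$ let $L_{i,j}$ be the Latin square obtained from $L_i$ and $L_j$ (in this order). Then $L_{1,3}$ and $L_{2,3}$ are UFS, and the Latin square obtained from $L_{1,3}$ and $L_{2,3}$ (in this order) equals $L_{1,2}$.
   Context: Two Latin squares $L,L'$ of order $n$ on $\{1,\ldots,n\}$ are UFS if for every row $i$ of $L$ and every row $j$ of $L'$ there is exactly one column $a$ with $L(i,a)=L'(j,a)$; a set of Latin squares is mutually UFS if every two distinct members are UFS. For UFS Latin squares $L,L'$, the Latin square obtained from $L$ and $L'$ (in this order) is the $n\times n$ array whose $(i,j)$-entry is $L(i,a)=L'(j,a)$ for the unique such $a$. -}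

module Defs where

open import Data.Nat using (ℕ)
open import Data.Fin using (Fin)
open import Data.Product using (Σ; _×_; proj₁; proj₂; ∃!)
open import Relation.Binary.PropositionalEquality using (_≡_)
open import Function.Definitions using (Injective)

-- A square array of order n on the symbol set Fin n (symbols 1..n ↦ 0..n-1),
-- indexed by (row, column).
Square : ℕ → Set
Square n = Fin n → Fin n → Fin n

-- Latin square: every row and every column contains each symbol exactly once;
-- for maps Fin n → Fin n this is injectivity of each row and each column.
record IsLatin {n : ℕ} (L : Square n) : Set where
  field
    row-inj : ∀ i → Injective _≡_ _≡_ (L i)
    col-inj : ∀ a → Injective _≡_ _≡_ (λ i → L i a)

UFS : {n : ℕ} → Square n → Square n → Set
UFS {n} L L' = ∀ (i j : Fin n) → ∃! _≡_ (λ (a : Fin n) → L i a ≡ L' j a)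

ufsCol : {n : ℕ} {L L' : Square n} → UFS L L' → Fin n → Fin n → Fin n
ufsCol u i j = proj₁ (u i j)

obtained : {n : ℕ} (L L' : Square n) → UFS L L' → Square n
obtained L L' u i j = L i (ufsCol u i j)

-- Let a be the column where row i of L₁ meets row j of L₂, with common symbol s.
-- The row k of L₃ carrying s in column a is a common column of row i of L₁₃ and
-- row j of L₂₃, both entries being s.  Conversely, if L₁₃(i,k') = L₂₃(j,k'), the
-- columns where row k' of L₃ meets L₁ and L₂ carry equal symbols of a row of L₃,
-- so they coincide; that column is then a meeting column of rows i and j, hence
-- equal to a, and k' = k because column a of L₃ is injective.  Only the Latin
-- property of L₃ and the UFS pairs (1,2), (1,3), (2,3) are used.
module Submission where

open import Defs
open import Data.Nat using (ℕ; zero; suc)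
open import Data.Nat.Properties using (n<1+n)
open import Data.Fin using (Fin; punchOut; _≟_; _<_)
open import Data.Fin.Properties using (any?; pigeonhole; punchOut-injective; <-irrefl)
open import Data.Product using (Σ; _×_; _,_; proj₁; proj₂; ∃; ∃₂)
open import Data.Empty using (⊥-elim)
open import Relation.Nullary using (¬_; yes; no)
open import Relation.Binary.PropositionalEquality using (_≡_; _≢_; sym; trans; cong; subst; module ≡-Reasoning)
open import Function.Definitions using (Injective)

injective⇒preimage : ∀ {n} (f : Fin n → Fin n) → Injective _≡_ _≡_ f →
                     ∀ s → ∃ λ k → f k ≡ s
injective⇒preimage {zero}  f inj ()
injective⇒preimage {suc m} f inj s with any? (λ k → f k ≟ s)
... | yes hit = hit
-- If f misses s, then punchOut s ∘ f injects Fin (suc m) into Fin m.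
... | no miss = ⊥-elim (collision (pigeonhole (n<1+n m) (λ k → punchOut (avoids k))))
  where
  avoids : ∀ k → s ≢ f k
  avoids k e = miss (k , sym e)
  collision : ¬ ∃₂ (λ i j → i < j × punchOut (avoids i) ≡ punchOut (avoids j))
  collision (i , j , i<j , eq) = <-irrefl (inj (punchOut-injective (avoids i) (avoids j) eq)) i<j

module _ {n} {L L′ : Square n} (u : UFS L L′) where

  ufsCol-agrees : ∀ i j → L i (ufsCol u i j) ≡ L′ j (ufsCol u i j)
  ufsCol-agrees i j = proj₁ (proj₂ (u i j))

  ufsCol-unique : ∀ {i j a} → L i a ≡ L′ j a → ufsCol u i j ≡ a
  ufsCol-unique {i} {j} = proj₂ (proj₂ (u i j))

  obtained-at : ∀ {i j a} → L i a ≡ L′ j a → obtained L L′ u i j ≡ L i a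
  obtained-at eq = cong (L _) (ufsCol-unique eq)

module _ {n} {L L′ L″ : Square n} (L″-row-inj : ∀ k → Injective _≡_ _≡_ (L″ k))
         (u : UFS L L″) (u′ : UFS L′ L″) where

  obtained-agree⇒ufsCol-agree : ∀ {i j k} →
    obtained L L″ u i k ≡ obtained L′ L″ u′ j k → ufsCol u i k ≡ ufsCol u′ j k
  obtained-agree⇒ufsCol-agree {i} {j} {k} eq = L″-row-inj k (begin
    L″ k (ufsCol u i k)   ≡⟨ sym (ufsCol-agrees u i k) ⟩
    L i (ufsCol u i k)    ≡⟨ eq ⟩
    L′ j (ufsCol u′ j k)  ≡⟨ ufsCol-agrees u′ j k ⟩
    L″ k (ufsCol u′ j k)  ∎)
    where open ≡-Reasoning

  obtained-agree⇒rows-agree : ∀ {i j k} →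
    obtained L L″ u i k ≡ obtained L′ L″ u′ j k →
    L i (ufsCol u i k) ≡ L′ j (ufsCol u i k)
  obtained-agree⇒rows-agree {j = j} eq =
    trans eq (cong (L′ j) (sym (obtained-agree⇒ufsCol-agree eq)))

lemma2p5 : (n : ℕ) (L₁ L₂ L₃ : Square n)
    → IsLatin L₁ → IsLatin L₂ → IsLatin L₃
    → (u₁₂ : UFS L₁ L₂) (u₂₁ : UFS L₂ L₁)
    → (u₁₃ : UFS L₁ L₃) (u₃₁ : UFS L₃ L₁)
    → (u₂₃ : UFS L₂ L₃) (u₃₂ : UFS L₃ L₂)
    → Σ (UFS (obtained L₁ L₃ u₁₃) (obtained L₂ L₃ u₂₃)) (λ v →
        ∀ (i j : Fin n) → obtained (obtained L₁ L₃ u₁₃) (obtained L₂ L₃ u₂₃) v i j ≡ obtained L₁ L₂ u₁₂ i j)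
lemma2p5 n L₁ L₂ L₃ _ _ l₃ u₁₂ _ u₁₃ _ u₂₃ _ = v , λ i j → L₁₃-at i j
  where
  open IsLatin l₃
  a : Fin n → Fin n → Fin n
  a = ufsCol u₁₂

  row₃ : ∀ i j → ∃ λ k → L₃ k (a i j) ≡ L₁ i (a i j)
  row₃ i j = injective⇒preimage _ (col-inj (a i j)) (L₁ i (a i j))

  k : Fin n → Fin n → Fin n
  k i j = proj₁ (row₃ i j)

  L₃-at : ∀ i j → L₃ (k i j) (a i j) ≡ L₁ i (a i j)
  L₃-at i j = proj₂ (row₃ i j)

  L₁₃-at : ∀ i j → obtained L₁ L₃ u₁₃ i (k i j) ≡ L₁ i (a i j)
  L₁₃-at i j = obtained-at u₁₃ (sym (L₃-at i j))

  L₂₃-at : ∀ i j → obtained L₂ L₃ u₂₃ j (k i j) ≡ L₁ i (a i j)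
  L₂₃-at i j = trans (obtained-at u₂₃ (trans (sym (ufsCol-agrees u₁₂ i j)) (sym (L₃-at i j))))
                     (sym (ufsCol-agrees u₁₂ i j))

  unique : ∀ i j {k′} → obtained L₁ L₃ u₁₃ i k′ ≡ obtained L₂ L₃ u₂₃ j k′ → k i j ≡ k′
  unique i j {k′} eq = col-inj (a i j) (trans (L₃-at i j) (sym L₃-k′-at))
    where
    meets : a i j ≡ ufsCol u₁₃ i k′
    meets = ufsCol-unique u₁₂ (obtained-agree⇒rows-agree row-inj u₁₃ u₂₃ eq)
    L₃-k′-at : L₃ k′ (a i j) ≡ L₁ i (a i j)
    L₃-k′-at = subst (λ c → L₃ k′ c ≡ L₁ i c) (sym meets) (sym (ufsCol-agrees u₁₃ i k′))

  v : UFS (obtained L₁ L₃ u₁₃) (obtained L₂ L₃ u₂₃)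
  v i j = k i j , trans (L₁₃-at i j) (sym (L₂₃-at i j)) , unique i j
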